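{- Let $\lambda,\mu$ be partitions and $n\in\mathbb{N}$ with $\ell(\lambda),\ell(\mu)\le n$. Let $k\in[n]$ satisfy $\lambda_k=\mu_k$. Define $\lambda^{\le k-1}=(\lambda_1,\ldots,\lambda_{k-1})$, $\lambda^{>k}=(\lambda_{k+1},\ldots,\lambda_n)$, $\mu^{\le k-1}=(\mu_1,\ldots,\mu_{k-1})$, $\mu^{>k}=(\mu_{k+1},\ldots,\mu_n)$. Then \[s_{\lambda/\mu}=s_{\lambda^{\le k-1}/\mu^{\le k-1}}\cdot\varphi^{ -k}\left(s_{\lambda^{>k}/\mu^{>k}}\right).\]
   Context: $R$ is the polynomial ring over $\mathbb{Z}$ in indeterminates $h_{r,s}$ ($r\ge1$, $s\in\mathbb{Z}$); set $h_{0,s}=1$ and $h_{r,s}=0$ for $r<0$. $\varphi$ is the ring automorphism of $R$ with $\varphi(h_{r,s})=h_{r,s+1}$, and $h_r:=h_{r,0}$, so $\varphi^sh_r=h_{r,s}$. For partitions $\lambda,\mu$ (not necessarily nested) and any $n$ with $\ell(\lambda),\ell(\mu)\le n$, $s_{\lambda/\mu}=\det\left(\varphi^{\mu_j-j+1}h_{\lambda_i-\mu_j-i+j}\right)_{1\le i,j\le n}$ (independent of $n$; for $n=0$ it is $1$). $\ell$ denotes length; $[n]=\{1,\ldots,n\}$. -}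

module Defs where

open import Data.Nat as ℕ using (ℕ; zero; suc; _⊔_)
open import Data.Integer as ℤ using (ℤ; +_; -[1+_]; _<_)
open import Data.Fin using (Fin; zero; suc; toℕ)
open import Data.List using (List; []; _∷_; length; map)
open import Relation.Nullary using (yes; no)

-- The ring R = ℤ[h_{r,s} : r ≥ 1, s ∈ ℤ], realised as the free
-- commutative ring on the indeterminates (terms modulo the
-- commutative-ring axioms, as an inductive setoid equality).

infixl 6 _+ᵗ_
infixl 7 _*ᵗ_
infix 4 _≈_

-- var r s  is the indeterminate h_{r+1,s}
data Term : Set where
  var  : ℕ → ℤ → Term
  0ᵗ   : Term
  1ᵗ   : Term
  _+ᵗ_ : Term → Term → Term
  _*ᵗ_ : Term → Term → Term
  -ᵗ_  : Term → Term

data _≈_ : Term → Term → Set where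
  ≈-refl  : ∀ {a} → a ≈ a
  ≈-sym   : ∀ {a b} → a ≈ b → b ≈ a
  ≈-trans : ∀ {a b c} → a ≈ b → b ≈ c → a ≈ c
  +-cong  : ∀ {a b c d} → a ≈ b → c ≈ d → a +ᵗ c ≈ b +ᵗ d
  *-cong  : ∀ {a b c d} → a ≈ b → c ≈ d → a *ᵗ c ≈ b *ᵗ d
  neg-cong : ∀ {a b} → a ≈ b → -ᵗ a ≈ -ᵗ b
  +-assoc : ∀ a b c → (a +ᵗ b) +ᵗ c ≈ a +ᵗ (b +ᵗ c)
  +-comm  : ∀ a b → a +ᵗ b ≈ b +ᵗ a
  +-identityˡ : ∀ a → 0ᵗ +ᵗ a ≈ a
  -‿inverseˡ  : ∀ a → (-ᵗ a) +ᵗ a ≈ 0ᵗ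
  *-assoc : ∀ a b c → (a *ᵗ b) *ᵗ c ≈ a *ᵗ (b *ᵗ c)
  *-comm  : ∀ a b → a *ᵗ b ≈ b *ᵗ a
  *-identityˡ : ∀ a → 1ᵗ *ᵗ a ≈ a
  distribʳ : ∀ a b c → (b +ᵗ c) *ᵗ a ≈ (b *ᵗ a) +ᵗ (c *ᵗ a)

hrs : ℤ → ℤ → Term
hrs (+ zero)    s = 1ᵗ
hrs (+ (suc r)) s = var r s
hrs -[1+ _ ]    s = 0ᵗ

h : ℤ → Term
h r = hrs r (+ 0)

φ^ : ℤ → Term → Term
φ^ a (var r s)  = var r (s ℤ.+ a)
φ^ a 0ᵗ         = 0ᵗ
φ^ a 1ᵗ         = 1ᵗ
φ^ a (x +ᵗ y)   = φ^ a x +ᵗ φ^ a y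
φ^ a (x *ᵗ y)   = φ^ a x *ᵗ φ^ a y
φ^ a (-ᵗ x)     = -ᵗ φ^ a x

sumᵗ : ∀ {n} → (Fin n → Term) → Term
sumᵗ {zero}  f = 0ᵗ
sumᵗ {suc n} f = f zero +ᵗ sumᵗ (λ j → f (suc j))

punch : ∀ {n} → Fin (suc n) → Fin n → Fin (suc n)
punch zero    k       = suc k
punch (suc j) zero    = zero
punch (suc j) (suc k) = suc (punch j k)

sign : ℕ → Term → Term
sign zero    t = t
sign (suc m) t = -ᵗ sign m t

det : ∀ n → (Fin n → Fin n → Term) → Term
det zero    M = 1ᵗ
det (suc n) M =
  sumᵗ (λ j → sign (toℕ j) (M zero j *ᵗ det n (λ i k → M (suc i) (punch j k))))

-- Partitions, as weakly decreasing finite lists of naturals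
-- (trailing zeros allowed; entries beyond the list are 0).

data Decreasing : List ℕ → Set where
  []  : Decreasing []
  [-] : ∀ {x} → Decreasing (x ∷ [])
  _∷_ : ∀ {x y xs} → y ℕ.≤ x → Decreasing (y ∷ xs) → Decreasing (x ∷ y ∷ xs)

-- i-th part, 1-indexed (part λ 0 is unused)
part : List ℕ → ℕ → ℕ
part []       _             = 0
part (x ∷ xs) zero          = 0
part (x ∷ xs) (suc zero)    = x
part (x ∷ xs) (suc (suc i)) = part xs (suc i)

ℓ : List ℕ → ℕ
ℓ []           = 0
ℓ (zero ∷ xs)  = ℓ xs
ℓ (suc _ ∷ xs) = suc (ℓ xs)

segment : List ℕ → ℕ → ℕ → List ℕ
segment lam a zero    = []
segment lam a (suc m) = part lam (suc a) ∷ segment lam (suc a) m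

upTo : ℕ → List ℕ → List ℕ
upTo k lam = segment lam 0 (k ℕ.∸ 1)

above : ℕ → ℕ → List ℕ → List ℕ
above k n lam = segment lam k (n ℕ.∸ k)

pos : ∀ {N} → Fin N → ℤ
pos i = + suc (toℕ i)

sAt : ℕ → List ℕ → List ℕ → Term
sAt N lam μ = det N (λ i j →
  φ^ (+ part μ (suc (toℕ j)) ℤ.- pos j ℤ.+ + 1)
     (h (+ part lam (suc (toℕ i)) ℤ.- + part μ (suc (toℕ j)) ℤ.- pos i ℤ.+ pos j)))

-- canonical choice N = max(#list λ, #list μ) (≥ ℓ(λ), ℓ(μ))
s : List ℕ → List ℕ → Term
s lam μ = sAt (length lam ⊔ length μ) lam μ

-- s_{λ/μ} is the determinant of the Jacobi–Trudi matrix M_{ij} = φ^{μ_j-j+1} h_{λ_i-μ_j-i+j},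
-- and M_{ij} = 0 whenever λ_i ≤ μ_j and j < i, since the index of h is then negative.
-- For i ≥ k > j we have λ_i ≤ λ_k = μ_k ≤ μ_j, so M is block upper triangular with
-- diagonal blocks of sizes k - 1, 1 and n - k.  The first block is the matrix of
-- λ^{≤k-1}/μ^{≤k-1}, the middle one is h_0 = 1, and the last is the matrix of
-- λ^{>k}/μ^{>k} with all indices shifted by k, which φ^{-k} undoes.  The same
-- triangularity shows that enlarging n beyond ℓ(λ), ℓ(μ) only adds a unitriangular
-- block, so the determinant does not depend on n.
module Submission where

open import Algebra.Bundles using (CommutativeRing)
open import Level using (0ℓ)
open import Data.Nat using (ℕ; zero; suc; _+_; _∸_; _≤_; _<_; _⊔_; z≤n; s≤s)
import Data.Nat.Properties as ℕ
open import Data.Integer as ℤ using (+_; -_; _⊖_)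
import Data.Integer.Properties as ℤ
open import Data.Integer.Tactic.RingSolver using (solve-∀)
open import Data.Fin using (Fin; toℕ) renaming (zero to fzero; suc to fsuc)
open import Data.Fin.Properties using (toℕ<n)
open import Data.Sum using (inj₁; inj₂)
open import Data.List using (List; []; _∷_; length)
open import Relation.Binary.PropositionalEquality as ≡ using (_≡_)
import Algebra.Consequences.Setoid as Consequences
open import Relation.Binary.Bundles using (Setoid)
open import Relation.Binary.Structures using (IsEquivalence)
open import Defs
  hiding (+-cong; *-cong; +-assoc; +-comm; +-identityˡ; -‿inverseˡ; *-assoc; *-comm; *-identityˡ; distribʳ)

≈-isEquivalence : IsEquivalence _≈_
≈-isEquivalence = record { refl = ≈-refl ; sym = ≈-sym ; trans = ≈-trans }

≈-setoid : Setoid 0ℓ 0ℓ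
≈-setoid = record { isEquivalence = ≈-isEquivalence }

commutativeRing : CommutativeRing 0ℓ 0ℓ
commutativeRing = record
  { Carrier = Term
  ; _≈_ = _≈_
  ; _+_ = _+ᵗ_
  ; _*_ = _*ᵗ_
  ; -_ = -ᵗ_
  ; 0# = 0ᵗ
  ; 1# = 1ᵗ
  ; isCommutativeRing = record
    { isRing = record
      { +-isAbelianGroup = record
        { isGroup = record
          { isMonoid = record
            { isSemigroup = record
              { isMagma = record { isEquivalence = ≈-isEquivalence ; ∙-cong = Defs.+-cong }
              ; assoc = Defs.+-assoc
              }
            ; identity = comm∧idˡ⇒id Defs.+-comm Defs.+-identityˡ
            }
          ; inverse = comm∧invˡ⇒inv Defs.+-comm Defs.-‿inverseˡ
          ; ⁻¹-cong = neg-cong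
          }
        ; comm = Defs.+-comm
        }
      ; *-cong = Defs.*-cong
      ; *-assoc = Defs.*-assoc
      ; *-identity = comm∧idˡ⇒id Defs.*-comm Defs.*-identityˡ
      ; distrib = comm∧distrʳ⇒distr Defs.+-cong Defs.*-comm Defs.distribʳ
      }
    ; *-comm = Defs.*-comm
    }
  }
  where
  open Consequences ≈-setoid

open CommutativeRing commutativeRing
  using ( refl; sym; trans; reflexive; +-cong; +-assoc; +-identityˡ; +-identityʳ
        ; *-cong; *-congˡ; *-congʳ; *-assoc; *-identityˡ; *-identityʳ; zeroˡ; zeroʳ
        ; semiring; ring )
open import Algebra.Properties.Ring ring using (-‿distribˡ-*; -0#≈0#)
open import Algebra.Properties.Semiring.Sum semiring
  using (sum; sum-cong-≋; sum-replicate-zero; *-distribʳ-sum; sum-syntax)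
open import Relation.Binary.Reasoning.Setoid ≈-setoid

sign-cong : ∀ m {x y} → x ≈ y → sign m x ≈ sign m y
sign-cong zero    x≈y = x≈y
sign-cong (suc m) x≈y = neg-cong (sign-cong m x≈y)

sign-zero : ∀ m → sign m 0ᵗ ≈ 0ᵗ
sign-zero zero    = refl
sign-zero (suc m) = trans (neg-cong (sign-zero m)) -0#≈0#

sign-*ˡ : ∀ m x y → sign m x *ᵗ y ≈ sign m (x *ᵗ y)
sign-*ˡ zero    x y = refl
sign-*ˡ (suc m) x y = trans (sym (-‿distribˡ-* _ y)) (neg-cong (sign-*ˡ m x y))

sign-*-zeroˡ : ∀ m {x} y → x ≈ 0ᵗ → sign m (x *ᵗ y) ≈ 0ᵗ
sign-*-zeroˡ m y x≈0 = trans (sign-cong m (trans (*-congʳ x≈0) (zeroˡ y))) (sign-zero m)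

sign-*-zeroʳ : ∀ m x {y} → y ≈ 0ᵗ → sign m (x *ᵗ y) ≈ 0ᵗ
sign-*-zeroʳ m x y≈0 = trans (sign-cong m (trans (*-congˡ y≈0) (zeroʳ x))) (sign-zero m)

sum-zero : ∀ {n} {f : Fin n → Term} → (∀ j → f j ≈ 0ᵗ) → sum f ≈ 0ᵗ
sum-zero {n} f≈0 = trans (sum-cong-≋ f≈0) (sum-replicate-zero n)

sum-splitAt : ∀ p q (g : ℕ → Term) →
  ∑[ j < p + q ] g (toℕ j) ≈ ∑[ j < p ] g (toℕ j) +ᵗ ∑[ j < q ] g (p + toℕ j)
sum-splitAt zero    q g = sym (+-identityˡ _)
sum-splitAt (suc p) q g = trans (+-cong refl (sum-splitAt p q (λ j → g (suc j)))) (sym (+-assoc _ _ _))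

Matrix : Set
Matrix = ℕ → ℕ → Term

Det : ℕ → Matrix → Term
Det n M = det n (λ i j → M (toℕ i) (toℕ j))

lowerRight : ℕ → Matrix → Matrix
lowerRight a M i j = M (a + i) (a + j)

skip : ℕ → ℕ → ℕ
skip zero    k       = suc k
skip (suc j) zero    = zero
skip (suc j) (suc k) = suc (skip j k)

minor : ℕ → Matrix → Matrix
minor j M i k = M (suc i) (skip j k)

toℕ-punch : ∀ {n} (j : Fin (suc n)) (k : Fin n) → toℕ (punch j k) ≡ skip (toℕ j) (toℕ k)
toℕ-punch fzero    k        = ≡.refl
toℕ-punch (fsuc j) fzero    = ≡.refl
toℕ-punch (fsuc j) (fsuc k) = ≡.cong suc (toℕ-punch j k)

skip-≤ : ∀ j k → skip j k ≤ suc k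
skip-≤ zero    k       = ℕ.≤-refl
skip-≤ (suc j) zero    = z≤n
skip-≤ (suc j) (suc k) = s≤s (skip-≤ j k)

skip-< : ∀ {j k} → k < j → skip j k ≡ k
skip-< {suc j} {zero}  _         = ≡.refl
skip-< {suc j} {suc k} (s≤s k<j) = ≡.cong suc (skip-< k<j)

skip-≥ : ∀ {j k} → j ≤ k → skip j k ≡ suc k
skip-≥ {zero}            _         = ≡.refl
skip-≥ {suc j} {suc k}   (s≤s j≤k) = ≡.cong suc (skip-≥ j≤k)

sumᵗ≡sum : ∀ {n} (f : Fin n → Term) → sumᵗ f ≡ sum f
sumᵗ≡sum {zero}  f = ≡.refl
sumᵗ≡sum {suc n} f = ≡.cong (f fzero +ᵗ_) (sumᵗ≡sum (λ j → f (fsuc j)))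

laplaceTermᶠ : ∀ n → (Fin (suc n) → Fin (suc n) → Term) → Fin (suc n) → Term
laplaceTermᶠ n A j = sign (toℕ j) (A fzero j *ᵗ det n (λ i k → A (fsuc i) (punch j k)))

det-expand : ∀ n A → det (suc n) A ≈ sum (laplaceTermᶠ n A)
det-expand n A = reflexive (sumᵗ≡sum (laplaceTermᶠ n A))

det-cong : ∀ n {A B : Fin n → Fin n → Term} → (∀ i j → A i j ≈ B i j) → det n A ≈ det n B
det-cong zero    A≈B = refl
det-cong (suc n) {A} {B} A≈B = begin
  det (suc n) A           ≈⟨ det-expand n A ⟩
  sum (laplaceTermᶠ n A)  ≈⟨ sum-cong-≋ (λ j → sign-cong (toℕ j)
                               (*-cong (A≈B fzero j) (det-cong n λ i k → A≈B (fsuc i) (punch j k)))) ⟩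
  sum (laplaceTermᶠ n B)  ≈⟨ det-expand n B ⟨
  det (suc n) B           ∎

Det-cong : ∀ n {M N : Matrix} → (∀ i j → i < n → j < n → M i j ≈ N i j) → Det n M ≈ Det n N
Det-cong n M≈N = det-cong n λ i j → M≈N (toℕ i) (toℕ j) (toℕ<n i) (toℕ<n j)

laplaceTerm : ℕ → Matrix → ℕ → Term
laplaceTerm n M j = sign j (M 0 j *ᵗ Det n (minor j M))

Det-expand : ∀ n M → Det (suc n) M ≈ ∑[ j < suc n ] laplaceTerm n M (toℕ j)
Det-expand n M = trans (det-expand n (λ i j → M (toℕ i) (toℕ j))) (sum-cong-≋ λ j →
  sign-cong (toℕ j) (*-congˡ {M 0 (toℕ j)}
    (det-cong n λ i k → reflexive (≡.cong (M (suc (toℕ i))) (toℕ-punch j k)))))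

Det-1 : ∀ M → Det 1 M ≈ M 0 0
Det-1 M = trans (+-identityʳ _) (*-identityʳ _)

Det-singular : ∀ a n M → a < n → (∀ i j → a ≤ i → j ≤ a → M i j ≈ 0ᵗ) → Det n M ≈ 0ᵗ
Det-singular zero (suc n) M _ M≈0 = trans (Det-expand n M) (sum-zero {suc n} term≈0)
  where
  term≈0 : ∀ j → laplaceTerm n M (toℕ j) ≈ 0ᵗ
  term≈0 fzero    = sign-*-zeroˡ 0 _ (M≈0 0 0 z≤n z≤n)
  term≈0 (fsuc j) = sign-*-zeroʳ (suc (toℕ j)) _
    (Det-singular zero n (minor (suc (toℕ j)) M) (ℕ.≤-<-trans z≤n (toℕ<n j))
      λ { i zero _ _ → M≈0 (suc i) 0 z≤n z≤n ; i (suc k) _ () })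
Det-singular (suc a) (suc n) M (s≤s a<n) M≈0 = trans (Det-expand n M) (sum-zero {suc n} term≈0)
  where
  term≈0 : ∀ j → laplaceTerm n M (toℕ j) ≈ 0ᵗ
  term≈0 j = sign-*-zeroʳ (toℕ j) _ (Det-singular a n (minor (toℕ j) M) a<n λ i k a≤i k≤a →
    M≈0 (suc i) (skip (toℕ j) k) (s≤s a≤i) (ℕ.≤-trans (skip-≤ (toℕ j) k) (s≤s k≤a)))

-- Expand along row 0: for j ≤ a the minor is again block triangular with the same
-- lower block, and for j > a it is singular.
Det-blockTriangular : ∀ a m M → (∀ i j → a ≤ i → j < a → M i j ≈ 0ᵗ) →
  Det (a + m) M ≈ Det a M *ᵗ Det m (lowerRight a M)
Det-blockTriangular zero    m M _   = sym (*-identityˡ _)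
Det-blockTriangular (suc a) m M M≈0 = begin
  Det (suc a + m) M
    ≈⟨ Det-expand (a + m) M ⟩
  ∑[ j < suc a + m ] laplaceTerm (a + m) M (toℕ j)
    ≈⟨ sum-splitAt (suc a) m (laplaceTerm (a + m) M) ⟩
  ∑[ j < suc a ] laplaceTerm (a + m) M (toℕ j) +ᵗ ∑[ t < m ] laplaceTerm (a + m) M (suc a + toℕ t)
    ≈⟨ +-cong (sum-cong-≋ λ j → leading (toℕ j) (toℕ<n j))
              (sum-zero λ t → trailing (toℕ t) (toℕ<n t)) ⟩
  ∑[ j < suc a ] (laplaceTerm a M (toℕ j) *ᵗ D) +ᵗ 0ᵗ
    ≈⟨ +-identityʳ _ ⟩
  ∑[ j < suc a ] (laplaceTerm a M (toℕ j) *ᵗ D)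
    ≈⟨ *-distribʳ-sum {suc a} D (λ j → laplaceTerm a M (toℕ j)) ⟨
  (∑[ j < suc a ] laplaceTerm a M (toℕ j)) *ᵗ D
    ≈⟨ *-congʳ (Det-expand a M) ⟨
  Det (suc a) M *ᵗ D
    ∎
  where
  D : Term
  D = Det m (lowerRight (suc a) M)

  leading : ∀ j → j < suc a → laplaceTerm (a + m) M j ≈ laplaceTerm a M j *ᵗ D
  leading j (s≤s j≤a) = begin
    sign j (M 0 j *ᵗ Det (a + m) (minor j M))
      ≈⟨ sign-cong j (*-congˡ (Det-blockTriangular a m (minor j M) λ i k a≤i k<a →
           M≈0 (suc i) (skip j k) (s≤s a≤i) (s≤s (ℕ.≤-trans (skip-≤ j k) k<a)))) ⟩
    sign j (M 0 j *ᵗ (Det a (minor j M) *ᵗ Det m (lowerRight a (minor j M))))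
      ≈⟨ sign-cong j (*-congˡ (*-congˡ (Det-cong m λ i k _ _ →
           reflexive (≡.cong (M (suc a + i)) (skip-≥ (ℕ.≤-trans j≤a (ℕ.m≤m+n a k))))))) ⟩
    sign j (M 0 j *ᵗ (Det a (minor j M) *ᵗ D))   ≈⟨ sign-cong j (*-assoc _ _ _) ⟨
    sign j ((M 0 j *ᵗ Det a (minor j M)) *ᵗ D)   ≈⟨ sign-*ˡ j _ D ⟨
    laplaceTerm a M j *ᵗ D                        ∎

  trailing : ∀ t → t < m → laplaceTerm (a + m) M (suc a + t) ≈ 0ᵗ
  trailing t t<m = sign-*-zeroʳ (suc a + t) _
    (Det-singular a (a + m) (minor (suc a + t) M) (ℕ.m<m+n a (ℕ.≤-<-trans z≤n t<m))
      λ i k a≤i k≤a →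
        M≈0 (suc i) (skip (suc a + t) k) (s≤s a≤i)
          (≡.subst (_< suc a) (≡.sym (skip-< (s≤s (ℕ.≤-trans k≤a (ℕ.m≤m+n a t))))) (s≤s k≤a)))

Det-pivot : ∀ n M → M 0 0 ≈ 1ᵗ → (∀ i → M (suc i) 0 ≈ 0ᵗ) → Det (suc n) M ≈ Det n (lowerRight 1 M)
Det-pivot n M pivot≈1 column≈0 = begin
  Det (1 + n) M                      ≈⟨ Det-blockTriangular 1 n M
                                          (λ { (suc i) zero _ _ → column≈0 i ; i (suc j) _ (s≤s ()) }) ⟩
  Det 1 M *ᵗ Det n (lowerRight 1 M)  ≈⟨ *-congʳ (trans (Det-1 M) pivot≈1) ⟩
  1ᵗ *ᵗ Det n (lowerRight 1 M)       ≈⟨ *-identityˡ _ ⟩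
  Det n (lowerRight 1 M)             ∎

Det-unitriangular : ∀ n M → (∀ i j → j < i → M i j ≈ 0ᵗ) → (∀ i → M i i ≈ 1ᵗ) → Det n M ≈ 1ᵗ
Det-unitriangular zero    M _   _   = refl
Det-unitriangular (suc n) M M≈0 M≈1 = trans
  (Det-pivot n M (M≈1 0) (λ i → M≈0 (suc i) 0 (s≤s z≤n)))
  (Det-unitriangular n (lowerRight 1 M) (λ i j j<i → M≈0 (suc i) (suc j) (s≤s j<i)) (λ i → M≈1 (suc i)))

φ^-identity : ∀ t → φ^ (+ 0) t ≡ t
φ^-identity (var r s) = ≡.cong (var r) (ℤ.+-identityʳ s)
φ^-identity 0ᵗ        = ≡.refl
φ^-identity 1ᵗ        = ≡.refl
φ^-identity (x +ᵗ y)  = ≡.cong₂ _+ᵗ_ (φ^-identity x) (φ^-identity y)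
φ^-identity (x *ᵗ y)  = ≡.cong₂ _*ᵗ_ (φ^-identity x) (φ^-identity y)
φ^-identity (-ᵗ x)    = ≡.cong -ᵗ_ (φ^-identity x)

φ^-φ^ : ∀ c d t → φ^ d (φ^ c t) ≡ φ^ (c ℤ.+ d) t
φ^-φ^ c d (var r s) = ≡.cong (var r) (ℤ.+-assoc s c d)
φ^-φ^ c d 0ᵗ        = ≡.refl
φ^-φ^ c d 1ᵗ        = ≡.refl
φ^-φ^ c d (x +ᵗ y)  = ≡.cong₂ _+ᵗ_ (φ^-φ^ c d x) (φ^-φ^ c d y)
φ^-φ^ c d (x *ᵗ y)  = ≡.cong₂ _*ᵗ_ (φ^-φ^ c d x) (φ^-φ^ c d y)
φ^-φ^ c d (-ᵗ x)    = ≡.cong -ᵗ_ (φ^-φ^ c d x)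

φ^-sign : ∀ c m t → φ^ c (sign m t) ≡ sign m (φ^ c t)
φ^-sign c zero    t = ≡.refl
φ^-sign c (suc m) t = ≡.cong -ᵗ_ (φ^-sign c m t)

φ^-sumᵗ : ∀ c {n} {f g : Fin n → Term} → (∀ j → φ^ c (f j) ≡ g j) → φ^ c (sumᵗ f) ≡ sumᵗ g
φ^-sumᵗ c {zero}  _  = ≡.refl
φ^-sumᵗ c {suc n} fg = ≡.cong₂ _+ᵗ_ (fg fzero) (φ^-sumᵗ c (λ j → fg (fsuc j)))

φ^-det : ∀ c n A → φ^ c (det n A) ≡ det n (λ i j → φ^ c (A i j))
φ^-det c zero    A = ≡.refl
φ^-det c (suc n) A = φ^-sumᵗ c λ j → ≡.trans (φ^-sign c (toℕ j) _)
  (≡.cong (λ d → sign (toℕ j) (φ^ c (A fzero j) *ᵗ d)) (φ^-det c n (λ i k → A (fsuc i) (punch j k))))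

h-⊖ : ∀ {m n} → m < n → h (m ⊖ n) ≡ 0ᵗ
h-⊖ {zero}  {suc n} _         = ≡.refl
h-⊖ {suc m} {suc n} (s≤s m<n) = ≡.trans (≡.cong h (ℤ.[1+m]⊖[1+n]≡m⊖n m n)) (h-⊖ m<n)

-- Matrices are indexed from 0: jtEntry λ_{i+1} μ_{j+1} i j is entry (i+1, j+1) of the
-- Jacobi–Trudi matrix.
jtEntry : ℕ → ℕ → ℕ → ℕ → Term
jtEntry a b i j = φ^ (+ b ℤ.- + suc j ℤ.+ + 1) (h (+ a ℤ.- + b ℤ.- + suc i ℤ.+ + suc j))

jtEntry-vanishes : ∀ {a b i j} → a ≤ b → j < i → jtEntry a b i j ≡ 0ᵗ
jtEntry-vanishes {a} {b} {i} {j} a≤b j<i =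
  ≡.cong (φ^ (+ b ℤ.- + suc j ℤ.+ + 1))
    (≡.trans (≡.cong h argument≡) (h-⊖ (ℕ.+-mono-≤-< a≤b (s≤s j<i))))
  where
  shuffle : ∀ A B I J → A ℤ.- B ℤ.- I ℤ.+ J ≡ (A ℤ.+ J) ℤ.- (B ℤ.+ I)
  shuffle = solve-∀
  argument≡ : + a ℤ.- + b ℤ.- + suc i ℤ.+ + suc j ≡ (a + suc j) ⊖ (b + suc i)
  argument≡ = ≡.trans (shuffle (+ a) (+ b) (+ suc i) (+ suc j)) (≡.trans
    (≡.sym (≡.cong₂ ℤ._-_ (ℤ.pos-+ a (suc j)) (ℤ.pos-+ b (suc i))))
    (ℤ.m-n≡m⊖n (a + suc j) (b + suc i)))

jtEntry-diagonal : ∀ a i → jtEntry a a i i ≡ 1ᵗ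
jtEntry-diagonal a i = ≡.cong (λ x → φ^ (+ a ℤ.- + suc i ℤ.+ + 1) (h x)) (cancel (+ a) (+ suc i))
  where
  cancel : ∀ A I → A ℤ.- A ℤ.- I ℤ.+ I ≡ + 0
  cancel = solve-∀

φ^-jtEntry : ∀ k a b i j → φ^ (- + k) (jtEntry a b i j) ≡ jtEntry a b (k + i) (k + j)
φ^-jtEntry k a b i j = ≡.trans (φ^-φ^ _ (- + k) _) (≡.cong₂ (λ c x → φ^ c (h x))
  (≡.trans (shift (+ b) (+ k) (+ suc j)) (≡.cong (λ y → + b ℤ.- y ℤ.+ + 1) (pos-suc-+ j)))
  (≡.trans (reindex (+ a) (+ b) (+ k) (+ suc i) (+ suc j))
           (≡.cong₂ (λ x y → + a ℤ.- + b ℤ.- x ℤ.+ y) (pos-suc-+ i) (pos-suc-+ j))))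
  where
  pos-suc-+ : ∀ n → + k ℤ.+ + suc n ≡ + suc (k + n)
  pos-suc-+ n = ≡.trans (≡.sym (ℤ.pos-+ k (suc n))) (≡.cong +_ (ℕ.+-suc k n))
  shift : ∀ B K J → B ℤ.- J ℤ.+ + 1 ℤ.+ - K ≡ B ℤ.- (K ℤ.+ J) ℤ.+ + 1
  shift = solve-∀
  reindex : ∀ A B K I J → A ℤ.- B ℤ.- I ℤ.+ J ≡ A ℤ.- B ℤ.- (K ℤ.+ I) ℤ.+ (K ℤ.+ J)
  reindex = solve-∀

Decreasing-tail : ∀ {x xs} → Decreasing (x ∷ xs) → Decreasing xs
Decreasing-tail [-]     = []
Decreasing-tail (_ ∷ d) = d

part-antitone : ∀ {λ′} → Decreasing λ′ → ∀ {i j} → i ≤ j → part λ′ (suc j) ≤ part λ′ (suc i)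
part-antitone []        _                       = z≤n
part-antitone [-]       {zero}  {zero}  _       = ℕ.≤-refl
part-antitone [-]       {zero}  {suc j} _       = z≤n
part-antitone [-]       {suc i} {suc j} _       = z≤n
part-antitone (_ ∷ _)   {zero}  {zero}  _       = ℕ.≤-refl
part-antitone (y≤x ∷ d) {zero}  {suc j} _       = ℕ.≤-trans (part-antitone d {0} {j} z≤n) y≤x
part-antitone (_ ∷ d)   {suc i} {suc j} (s≤s i≤j) = part-antitone d i≤j

part-beyond-ℓ : ∀ {λ′ N i} → Decreasing λ′ → ℓ λ′ ≤ N → N ≤ i → part λ′ (suc i) ≡ 0
part-beyond-ℓ {[]}                        _ _         _         = ≡.refl
part-beyond-ℓ {zero ∷ _}  {i = i}         d _         _         = ℕ.n≤0⇒n≡0 (part-antitone d {0} {i} z≤n)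
part-beyond-ℓ {suc _ ∷ _} {suc N} {suc i} d (s≤s ℓ≤N) (s≤s N≤i) = part-beyond-ℓ (Decreasing-tail d) ℓ≤N N≤i

ℓ≤length : ∀ λ′ → ℓ λ′ ≤ length λ′
ℓ≤length []           = z≤n
ℓ≤length (zero ∷ xs)  = ℕ.m≤n⇒m≤1+n (ℓ≤length xs)
ℓ≤length (suc _ ∷ xs) = s≤s (ℓ≤length xs)

length-segment : ∀ λ′ a m → length (segment λ′ a m) ≡ m
length-segment λ′ a zero    = ≡.refl
length-segment λ′ a (suc m) = ≡.cong suc (length-segment λ′ (suc a) m)

part-segment : ∀ λ′ a {m i} → i < m → part (segment λ′ a m) (suc i) ≡ part λ′ (suc (a + i))
part-segment λ′ a {suc m} {zero}  _         = ≡.cong (λ x → part λ′ (suc x)) (≡.sym (ℕ.+-identityʳ a))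
part-segment λ′ a {suc m} {suc i} (s≤s i<m) =
  ≡.trans (part-segment λ′ (suc a) i<m) (≡.cong (λ x → part λ′ (suc x)) (≡.sym (ℕ.+-suc a i)))

jacobiTrudi : List ℕ → List ℕ → Matrix
jacobiTrudi λ′ μ i j = jtEntry (part λ′ (suc i)) (part μ (suc j)) i j

jacobiTrudi-vanishes : ∀ λ′ μ {i j} → part λ′ (suc i) ≤ part μ (suc j) → j < i →
  jacobiTrudi λ′ μ i j ≈ 0ᵗ
jacobiTrudi-vanishes λ′ μ λi≤μj j<i = reflexive (jtEntry-vanishes λi≤μj j<i)

module _ {λ′ μ : List ℕ} (dλ : Decreasing λ′) (dμ : Decreasing μ) where

  Det-jacobiTrudi-pad : ∀ {N N′} → ℓ λ′ ≤ N → ℓ μ ≤ N → N ≤ N′ →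
    Det N′ (jacobiTrudi λ′ μ) ≈ Det N (jacobiTrudi λ′ μ)
  Det-jacobiTrudi-pad {N} {N′} ℓλ≤N ℓμ≤N N≤N′ = begin
    Det N′ M                            ≡⟨ ≡.cong (λ n → Det n M) (ℕ.m+[n∸m]≡n N≤N′) ⟨
    Det (N + d) M                       ≈⟨ Det-blockTriangular N d M (λ i j N≤i j<N →
                                             vanishes N≤i (ℕ.<-≤-trans j<N N≤i)) ⟩
    Det N M *ᵗ Det d (lowerRight N M)   ≈⟨ *-congˡ (Det-unitriangular d (lowerRight N M)
                                             (λ i j j<i → vanishes (ℕ.m≤m+n N i) (ℕ.+-monoʳ-< N j<i))
                                             (λ i → reflexive (diagonal (ℕ.m≤m+n N i)))) ⟩
    Det N M *ᵗ 1ᵗ                       ≈⟨ *-identityʳ _ ⟩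
    Det N M                             ∎
    where
    M = jacobiTrudi λ′ μ
    d = N′ ∸ N
    vanishes : ∀ {i j} → N ≤ i → j < i → M i j ≈ 0ᵗ
    vanishes N≤i = jacobiTrudi-vanishes λ′ μ
      (ℕ.≤-trans (ℕ.≤-reflexive (part-beyond-ℓ dλ ℓλ≤N N≤i)) z≤n)
    diagonal : ∀ {i} → N ≤ i → M i i ≡ 1ᵗ
    diagonal {i} N≤i = ≡.trans
      (≡.cong₂ (λ a b → jtEntry a b i i) (part-beyond-ℓ dλ ℓλ≤N N≤i) (part-beyond-ℓ dμ ℓμ≤N N≤i))
      (jtEntry-diagonal 0 i)

  Det-jacobiTrudi-independent : ∀ {N N′} → ℓ λ′ ≤ N → ℓ μ ≤ N → ℓ λ′ ≤ N′ → ℓ μ ≤ N′ →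
    Det N (jacobiTrudi λ′ μ) ≈ Det N′ (jacobiTrudi λ′ μ)
  Det-jacobiTrudi-independent {N} {N′} ℓλ≤N ℓμ≤N ℓλ≤N′ ℓμ≤N′ with ℕ.≤-total N N′
  ... | inj₁ N≤N′ = sym (Det-jacobiTrudi-pad ℓλ≤N ℓμ≤N N≤N′)
  ... | inj₂ N′≤N = Det-jacobiTrudi-pad ℓλ≤N′ ℓμ≤N′ N′≤N

  s≈Det-jacobiTrudi : ∀ {n} → ℓ λ′ ≤ n → ℓ μ ≤ n → s λ′ μ ≈ Det n (jacobiTrudi λ′ μ)
  s≈Det-jacobiTrudi = Det-jacobiTrudi-independent
    (ℕ.≤-trans (ℓ≤length λ′) (ℕ.m≤m⊔n _ _)) (ℕ.≤-trans (ℓ≤length μ) (ℕ.m≤n⊔m _ _))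

  Det-jacobiTrudi-split : ∀ {k} → part λ′ (suc k) ≡ part μ (suc k) → ∀ r →
    Det (k + suc r) (jacobiTrudi λ′ μ)
      ≈ Det k (jacobiTrudi λ′ μ) *ᵗ Det r (lowerRight (suc k) (jacobiTrudi λ′ μ))
  Det-jacobiTrudi-split {k} λk≡μk r = begin
    Det (k + suc r) M
      ≈⟨ Det-blockTriangular k (suc r) M (λ i j k≤i j<k → vanishes k≤i (ℕ.<⇒≤ j<k) (ℕ.<-≤-trans j<k k≤i)) ⟩
    Det k M *ᵗ Det (suc r) (lowerRight k M)
      ≈⟨ *-congˡ (Det-pivot r (lowerRight k M) pivot≈1 column≈0) ⟩
    Det k M *ᵗ Det r (lowerRight 1 (lowerRight k M))
      ≈⟨ *-congˡ (Det-cong r λ i j _ _ → reflexive (≡.cong₂ M (ℕ.+-suc k i) (ℕ.+-suc k j))) ⟩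
    Det k M *ᵗ Det r (lowerRight (suc k) M)
      ∎
    where
    M = jacobiTrudi λ′ μ
    vanishes : ∀ {i j} → k ≤ i → j ≤ k → j < i → M i j ≈ 0ᵗ
    vanishes k≤i j≤k = jacobiTrudi-vanishes λ′ μ
      (ℕ.≤-trans (part-antitone dλ k≤i) (ℕ.≤-trans (ℕ.≤-reflexive λk≡μk) (part-antitone dμ j≤k)))
    pivot≈1 : M (k + 0) (k + 0) ≈ 1ᵗ
    pivot≈1 rewrite ℕ.+-identityʳ k = reflexive (≡.trans
      (≡.cong (λ b → jtEntry (part λ′ (suc k)) b k k) (≡.sym λk≡μk))
      (jtEntry-diagonal (part λ′ (suc k)) k))
    column≈0 : ∀ i → M (k + suc i) (k + 0) ≈ 0ᵗ
    column≈0 i = vanishes (ℕ.m≤m+n k (suc i)) (ℕ.≤-reflexive (ℕ.+-identityʳ k)) (ℕ.+-monoʳ-< k (s≤s z≤n))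

φ^-s-segment : ∀ λ′ μ a m →
  φ^ (- + a) (s (segment λ′ a m) (segment μ a m)) ≈ Det m (lowerRight a (jacobiTrudi λ′ μ))
φ^-s-segment λ′ μ a m = begin
  φ^ c (s (segment λ′ a m) (segment μ a m))  ≡⟨ ≡.cong (λ N → φ^ c (Det N Mₐ)) size≡m ⟩
  φ^ c (Det m Mₐ)                             ≡⟨ φ^-det c m (λ i j → Mₐ (toℕ i) (toℕ j)) ⟩
  Det m (λ i j → φ^ c (Mₐ i j))               ≈⟨ Det-cong m (λ i j i<m j<m → reflexive (entry≡ i<m j<m)) ⟩
  Det m (lowerRight a (jacobiTrudi λ′ μ))     ∎
  where
  c = - + a
  Mₐ = jacobiTrudi (segment λ′ a m) (segment μ a m)
  size≡m : length (segment λ′ a m) ⊔ length (segment μ a m) ≡ m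
  size≡m = ≡.trans (≡.cong₂ _⊔_ (length-segment λ′ a m) (length-segment μ a m)) (ℕ.⊔-idem m)
  entry≡ : ∀ {i j} → i < m → j < m → φ^ c (Mₐ i j) ≡ lowerRight a (jacobiTrudi λ′ μ) i j
  entry≡ {i} {j} i<m j<m = ≡.trans
    (≡.cong₂ (λ x y → φ^ c (jtEntry x y i j)) (part-segment λ′ a i<m) (part-segment μ a j<m))
    (φ^-jtEntry a (part λ′ (suc (a + i))) (part μ (suc (a + j))) i j)

s-initialSegment : ∀ λ′ μ m → s (segment λ′ 0 m) (segment μ 0 m) ≈ Det m (jacobiTrudi λ′ μ)
s-initialSegment λ′ μ m = trans (reflexive (≡.sym (φ^-identity _))) (φ^-s-segment λ′ μ 0 m)

mainTheorem14 : (λ′ μ : List ℕ) → Decreasing λ′ → Decreasing μ →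
    (n : ℕ) → ℓ λ′ ≤ n → ℓ μ ≤ n →
    (k : ℕ) → 1 ≤ k → k ≤ n → part λ′ k ≡ part μ k →
    s λ′ μ ≈ s (upTo k λ′) (upTo k μ) *ᵗ φ^ (- (+ k)) (s (above k n λ′) (above k n μ))
mainTheorem14 λ′ μ dλ dμ n ℓλ≤n ℓμ≤n (suc k) _ k<n λk≡μk = begin
  s λ′ μ                                   ≈⟨ s≈Det-jacobiTrudi dλ dμ ℓλ≤n ℓμ≤n ⟩
  Det n M                                  ≡⟨ ≡.cong (λ N → Det N M) k+suc[r]≡n ⟨
  Det (k + suc r) M                        ≈⟨ Det-jacobiTrudi-split dλ dμ λk≡μk r ⟩
  Det k M *ᵗ Det r (lowerRight (suc k) M)  ≈⟨ *-cong (s-initialSegment λ′ μ k)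
                                                       (φ^-s-segment λ′ μ (suc k) r) ⟨
  s (upTo (suc k) λ′) (upTo (suc k) μ) *ᵗ φ^ (- + suc k) (s (above (suc k) n λ′) (above (suc k) n μ))
                                           ∎
  where
  M = jacobiTrudi λ′ μ
  r = n ∸ suc k
  k+suc[r]≡n : k + suc r ≡ n
  k+suc[r]≡n = ≡.trans (ℕ.+-suc k r) (ℕ.m+[n∸m]≡n k<n)
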